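{- In every playable coalition model, for every coalition $C\subseteq N$ and every $\varphi\in\mathcal L_{CL}$, the formula $\mathrm{FC}_C(\varphi)\to\mathrm{FI}_{\overline C}(\varphi)$ is true at every state.
   Context: Let $N=\{1,\dots,n\}$ be a finite set of agents, $\mathsf{Prop}$ a countable set of atoms; a coalition is any $C\subseteq N$ and $\overline C=N\setminus C$. The language $\mathcal L_{CL}$: $\varphi::=p\mid\neg\varphi\mid(\varphi\wedge\psi)\mid[C]\varphi$. A coalition model is $\mathcal M=(W,E,V)$ with $W\ne\emptyset$, $E_w(C)\subseteq\mathcal P(W)$ for each $w\in W$, $C\subseteq N$, and $V:\mathsf{Prop}\to\mathcal P(W)$; atoms via $V$, Booleans classical, $\mathcal M,w\models[C]\varphi$ iff $[\![\varphi]\!]_{\mathcal M}:=\{u\mid\mathcal M,u\models\varphi\}\in E_w(C)$. For $X\subseteq W$ write $\overline X=W\setminus X$. $E_w$ is playable if: (i) $\emptyset\notin E_w(C)$ for all $C$; (ii) $W\in E_w(C)$ for all $C$; (iii) if $X\in E_w(C)$ and $X\subseteq Y\subseteq W$ then $Y\in E_w(C)$; (iv) if $C\cap D=\emptyset$, $X\in E_w(C)$, $Y\in E_w(D)$ then $X\cap Y\in E_w(C\cup D)$; (v) for every $X\subseteq W$, $X\notin E_w(\emptyset)$ iff $\overline X\in E_w(N)$. The model is playable if every $E_w$ is. Abbreviations: $\mathrm{FC}_C(\varphi):=[C]\varphi\wedge[C]\neg\varphi$; $\mathrm{FI}_C(\varphi):=\neg[C]\varphi\wedge\neg[C]\neg\varphi$.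 -}

module Defs where

open import Data.Nat using (ℕ)
open import Data.Product using (_×_; ∃)
open import Data.Empty using () renaming (⊥ to False)
open import Data.Unit using () renaming (⊤ to True)
open import Relation.Nullary using (¬_)
open import Data.Fin.Subset using (Subset; ∁; _∩_; _∪_; Empty)
  renaming (⊥ to ∅ᶜ; ⊤ to Nᶜ)

Atom : Set
Atom = ℕ

-- Coalitions over agents N = {1..n} (represented as Fin n): subsets of Fin n.
Coalition : ℕ → Set
Coalition n = Subset n

data Form (n : ℕ) : Set where
  atom : Atom → Form n
  ¬'_  : Form n → Form n
  _∧'_ : Form n → Form n → Form n
  [_]_ : Coalition n → Form n → Form n

_⇒'_ : ∀ {n} → Form n → Form n → Form n
φ ⇒' ψ = ¬' (φ ∧' (¬' ψ))

FC : ∀ {n} → Coalition n → Form n → Form n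
FC C φ = ([ C ] φ) ∧' ([ C ] (¬' φ))

FI : ∀ {n} → Coalition n → Form n → Form n
FI C φ = (¬' ([ C ] φ)) ∧' (¬' ([ C ] (¬' φ)))

Pred : Set → Set₁
Pred W = W → Set

record Model (n : ℕ) : Set₁ where
  field
    W        : Set
    nonempty : W
    E        : W → Coalition n → Pred W → Set
    V        : Atom → Pred W

module _ {n : ℕ} (M : Model n) where
  open Model M

  ⟦_⟧ : Form n → Pred W
  ⟦ atom p ⟧ w = V p w
  ⟦ ¬' φ ⟧ w = ¬ (⟦ φ ⟧ w)
  ⟦ φ ∧' ψ ⟧ w = ⟦ φ ⟧ w × ⟦ ψ ⟧ w
  ⟦ [ C ] φ ⟧ w = E w C ⟦ φ ⟧

  record PlayableAt (w : W) : Set₁ where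
    field
      no-empty   : ∀ C → ¬ E w C (λ _ → False)
      full       : ∀ C → E w C (λ _ → True)
      monotone   : ∀ C (X Y : Pred W) → (∀ u → X u → Y u) → E w C X → E w C Y
      superadd   : ∀ C D (X Y : Pred W) → Empty (C ∩ D) →
                   E w C X → E w D Y → E w (C ∪ D) (λ u → X u × Y u)
      regular-⇒  : ∀ (X : Pred W) → ¬ E w ∅ᶜ X → E w Nᶜ (λ u → ¬ X u)
      regular-⇐  : ∀ (X : Pred W) → E w Nᶜ (λ u → ¬ X u) → ¬ E w ∅ᶜ X

  Playable : Set₁
  Playable = ∀ w → PlayableAt w

_,_⊨_ : ∀ {n} (M : Model n) → Model.W M → Form n → Set
M , w ⊨ φ = ⟦_⟧ M φ w

-- Disjoint coalitions cannot force disjoint sets of states: by superadditivity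
-- their union would force the intersection, which is empty. So if C forces both
-- φ and ¬φ, the complementary coalition ∁ C can force neither φ nor ¬φ.
module Submission where

open import Defs
open import Data.Nat using (ℕ)
open import Data.Fin.Subset using (∁; _∩_; _∪_; Empty)
open import Data.Fin.Subset.Properties using (x∈p∩q⁻; x∈p⇒x∉∁p)
open import Data.Product using (_,_)
open import Relation.Nullary using (¬_)

Empty-∩-∁ : ∀ {n} (C : Coalition n) → Empty (C ∩ ∁ C)
Empty-∩-∁ C (x , x∈C∩∁C) with x∈p∩q⁻ C (∁ C) x∈C∩∁C
... | x∈C , x∈∁C = x∈p⇒x∉∁p x∈C x∈∁C

module _ {n : ℕ} (M : Model n) where
  open Model M

  disjoint-¬force-disjoint : ∀ {w} → PlayableAt M w →
    ∀ {C D} → Empty (C ∩ D) → ∀ {X Y : Pred W} → (∀ u → X u → ¬ Y u) →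
    E w C X → ¬ E w D Y
  disjoint-¬force-disjoint playable {C} {D} C∩D≡∅ {X} {Y} X∩Y≡∅ C⊩X D⊩Y =
    no-empty (C ∪ D)
      (monotone (C ∪ D) _ _ (λ { u (Xu , Yu) → X∩Y≡∅ u Xu Yu })
        (superadd C D X Y C∩D≡∅ C⊩X D⊩Y))
    where open PlayableAt playable

proposition4p4 : (n : ℕ) (M : Model n) → Playable M →
    ∀ (C : Coalition n) (φ : Form n) (w : Model.W M) →
    M , w ⊨ (FC C φ ⇒' FI (∁ C) φ)
proposition4p4 n M playable C φ w ((C⊩φ , C⊩¬φ) , ¬FI) = ¬FI (∁C⊮φ , ∁C⊮¬φ)
  where
  ∁C⊮φ : ¬ (M , w ⊨ ([ ∁ C ] φ))
  ∁C⊮φ = disjoint-¬force-disjoint M (playable w) (Empty-∩-∁ C)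
           (λ u ¬φu φu → ¬φu φu) C⊩¬φ
  ∁C⊮¬φ : ¬ (M , w ⊨ ([ ∁ C ] (¬' φ)))
  ∁C⊮¬φ = disjoint-¬force-disjoint M (playable w) (Empty-∩-∁ C)
            (λ u φu ¬φu → ¬φu φu) C⊩φ
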